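{- Let $a,b\ge0$ be integers and let $X_{i_1,i_2}$, $i_1\in\{0,\dots,2^a-1\}$, $i_2\in\{0,\dots,2^b-1\}$, be i.i.d. Poisson random variables with mean $1$. Let $R_i=\sum_{i_2}X_{i,i_2}$ (row sums), $C_j=\sum_{i_1}X_{i_1,j}$ (column sums), and $S=\sum_{i_1,i_2}X_{i_1,i_2}$. Then the random vectors $(C_0,\dots,C_{2^b-1})$ and $(R_0,\dots,R_{2^a-1})$ are conditionally independent given $S$. -}

module Defs where

open import Data.Bool using (Bool; true; false; _∧_; if_then_else_)
open import Data.Nat as ℕ using (ℕ; zero; suc; _^_; _!)
open import Data.Nat.Properties using (_!≢0)
open import Data.Integer using (+_)
open import Data.Rational using (ℚ; _/_; _+_; _*_; 0ℚ; 1ℚ)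
open import Data.List as List using (List; []; _∷_; upTo; concatMap)
open import Data.Vec as Vec using (Vec; []; _∷_; transpose)
open import Data.Vec.Properties using (≡-dec)
open import Relation.Nullary.Decidable using (⌊_⌋)

Array : ℕ → ℕ → Set
Array p q = Vec (Vec ℕ q) p

Mat : ℕ → ℕ → Set
Mat a b = Array (2 ^ a) (2 ^ b)

rowSums : ∀ {p q} → Array p q → Vec ℕ p
rowSums = Vec.map Vec.sum

colSums : ∀ {p q} → Array p q → Vec ℕ q
colSums x = Vec.map Vec.sum (transpose x)

total : ∀ {p q} → Array p q → ℕ
total x = Vec.sum (rowSums x)

-- Poisson(1) point mass, rescaled by the constant e:
--   P(X = k) = e⁻¹ / k!,   poissonMass k = e · P(X = k) = 1 / k!.
poissonMass : ℕ → ℚ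
poissonMass k = (+ 1 / (k !)) {{k !≢0}}

prodℚ : ∀ {m} → Vec ℚ m → ℚ
prodℚ = Vec.foldr _ _*_ 1ℚ

sumℚ : List ℚ → ℚ
sumℚ = List.foldr _+_ 0ℚ

-- Joint mass of the i.i.d. array at x, rescaled by e^(2^a·2^b):
--   P(X = x) = e^{-2^a 2^b} · jointMass x.
jointMass : ∀ {p q} → Array p q → ℚ
jointMass x = prodℚ (Vec.map (λ row → prodℚ (Vec.map poissonMass row)) x)

vecsOver : ∀ {A : Set} → List A → (m : ℕ) → List (Vec A m)
vecsOver xs zero    = [] ∷ []
vecsOver xs (suc m) = concatMap (λ k → List.map (k ∷_) (vecsOver xs m)) xs

-- All arrays whose entries are ≤ n (a finite list, without repetition);
-- it contains every array with total n.
boundedMats : (a b n : ℕ) → List (Mat a b)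
boundedMats a b n = vecsOver (vecsOver (upTo (suc n)) (2 ^ b)) (2 ^ a)

-- Rescaled probability of the event {S = n} ∩ E, for a (Boolean) event E:
--   P(S = n ∧ E) = e^{-2^a 2^b} · probS a b n E.
probS : (a b n : ℕ) → (Mat a b → Bool) → ℚ
probS a b n E =
  sumℚ (List.map (λ x → if ⌊ total x ℕ.≟ n ⌋ ∧ E x then jointMass x else 0ℚ)
                 (boundedMats a b n))

rowEvent : ∀ {p q} → Vec ℕ p → Array p q → Bool
rowEvent r x = ⌊ ≡-dec ℕ._≟_ (rowSums x) r ⌋

colEvent : ∀ {p q} → Vec ℕ q → Array p q → Bool
colEvent c x = ⌊ ≡-dec ℕ._≟_ (colSums x) c ⌋

-- Conditional independence of R and C given S (discrete variables, with
-- P(S = n) > 0 for every n):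
--   P(R=r, C=c, S=n) · P(S=n) = P(R=r, S=n) · P(C=c, S=n)
-- for all n, r, c.  Both sides carry the same factor e^{-2·2^a 2^b}, which
-- is cancelled here.
CondIndepRowsColsGivenTotal : ℕ → ℕ → Set
CondIndepRowsColsGivenTotal a b =
  (n : ℕ) (r : Vec ℕ (2 ^ a)) (c : Vec ℕ (2 ^ b)) →
  probS a b n (λ x → rowEvent r x ∧ colEvent c x) * probS a b n (λ _ → true)
    ≡ probS a b n (rowEvent r) * probS a b n (colEvent c)
  where open import Relation.Binary.PropositionalEquality using (_≡_)

-- Conditionally on S = n the Poisson array is multinomial: E[F(X) ; S = n] is e^{-2^a 2^b}/n!
-- times the sum of F(e_{c₁} + ⋯ + e_{cₙ}) over all sequences c₁ … cₙ of cells.  This follows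
-- by induction on n from the size-bias identity E[|X| H(X)] = Σ_c E[H(X + e_c)] of independent
-- Poisson(1) coordinates, which lifts from one coordinate to vectors, hence to arrays, because
-- |(a ∷ v)| = |a| + |v|.
-- A ball in cell (i, j) raises the row sum i and the column sum j, and a sequence of cells is
-- just a pair of a sequence of rows and a sequence of columns, so the sum of f(R) g(C) over
-- cell sequences factors as (Σ of f over row sequences) · (Σ of g over column sequences).
-- Both sides of the theorem are therefore the same multiple of the same product of four sums.

module Submission where

open import Algebra.Bundles using (CommutativeRing)
open import Data.Bool using (Bool; true; false; if_then_else_; _∧_)
open import Data.Empty using (⊥-elim)
open import Data.Fin using (Fin; zero; suc)
import Data.Integer as ℤ
open import Data.List as List using (List; []; _∷_; _++_; [_]; concatMap; cartesianProduct; allFin; upTo)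
import Data.List.Properties as List
open import Data.Nat as ℕ using (ℕ; zero; suc; _<_; _≤_; _!; _^_; NonZero)
open import Data.Nat.Properties using (_!≢0)
import Data.Nat.Properties as ℕ
open import Data.Product using (_×_; _,_; proj₁; proj₂)
open import Data.Rational using (ℚ; _/_; _+_; _*_; 0ℚ; 1ℚ; toℚᵘ)
open import Data.Rational.Properties
open import Data.Rational.Solver using (module +-*-Solver)
import Data.Rational.Unnormalised as ℚᵘ
import Data.Rational.Unnormalised.Properties as ℚᵘ
open import Data.Unit using (⊤; tt)
open import Data.Vec as Vec using (Vec; []; _∷_; _[_]%=_; replicate; zipWith)
import Data.Vec.Properties as Vec
open import Data.Vec.Properties using (≡-dec)
open import Function using (_∘_)
open import Relation.Nullary.Decidable using (⌊_⌋; yes; no)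
open import Relation.Binary.PropositionalEquality using (_≡_; refl; sym; trans; cong; cong₂; subst; module ≡-Reasoning)
open ≡-Reasoning
open +-*-Solver using (solve; _:+_; _:*_; _:=_)

open import Defs

private
  variable
    A B : Set

∑ : List A → (A → ℚ) → ℚ
∑ xs f = sumℚ (List.map f xs)

syntax ∑ xs (λ x → e) = ∑[ x ∈ xs ] e

∑-cong : ∀ (xs : List A) {f g : A → ℚ} → (∀ x → f x ≡ g x) → ∑ xs f ≡ ∑ xs g
∑-cong []       f≗g = refl
∑-cong (x ∷ xs) f≗g = cong₂ _+_ (f≗g x) (∑-cong xs f≗g)

∑-zero : ∀ (xs : List A) → ∑[ x ∈ xs ] 0ℚ ≡ 0ℚ
∑-zero []       = refl
∑-zero (x ∷ xs) = trans (+-identityˡ _) (∑-zero xs)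

∑-distrib-+ : ∀ (xs : List A) (f g : A → ℚ) → ∑[ x ∈ xs ] (f x + g x) ≡ ∑ xs f + ∑ xs g
∑-distrib-+ []       f g = sym (+-identityˡ 0ℚ)
∑-distrib-+ (x ∷ xs) f g = begin
  (f x + g x) + ∑[ y ∈ xs ] (f y + g y)  ≡⟨ cong ((f x + g x) +_) (∑-distrib-+ xs f g) ⟩
  (f x + g x) + (∑ xs f + ∑ xs g)        ≡⟨ +-assoc (f x) (g x) _ ⟩
  f x + (g x + (∑ xs f + ∑ xs g))        ≡⟨ cong (f x +_) (sym (+-assoc (g x) _ _)) ⟩
  f x + ((g x + ∑ xs f) + ∑ xs g)        ≡⟨ cong (λ z → f x + (z + ∑ xs g)) (+-comm (g x) _) ⟩
  f x + ((∑ xs f + g x) + ∑ xs g)        ≡⟨ cong (f x +_) (+-assoc (∑ xs f) (g x) _) ⟩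
  f x + (∑ xs f + (g x + ∑ xs g))        ≡⟨ sym (+-assoc (f x) _ _) ⟩
  (f x + ∑ xs f) + (g x + ∑ xs g)        ∎

*-distribˡ-∑ : ∀ c (xs : List A) (f : A → ℚ) → c * ∑ xs f ≡ ∑[ x ∈ xs ] (c * f x)
*-distribˡ-∑ c []       f = *-zeroʳ c
*-distribˡ-∑ c (x ∷ xs) f = trans (*-distribˡ-+ c (f x) _) (cong (c * f x +_) (*-distribˡ-∑ c xs f))

∑-++ : ∀ (xs ys : List A) (f : A → ℚ) → ∑ (xs ++ ys) f ≡ ∑ xs f + ∑ ys f
∑-++ []       ys f = sym (+-identityˡ _)
∑-++ (x ∷ xs) ys f = trans (cong (f x +_) (∑-++ xs ys f)) (sym (+-assoc (f x) _ _))

∑-map : ∀ (h : A → B) (xs : List A) (f : B → ℚ) → ∑ (List.map h xs) f ≡ ∑[ x ∈ xs ] f (h x)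
∑-map h []       f = refl
∑-map h (x ∷ xs) f = cong (f (h x) +_) (∑-map h xs f)

∑-concatMap : ∀ (h : A → List B) (xs : List A) (f : B → ℚ) →
              ∑ (concatMap h xs) f ≡ ∑[ x ∈ xs ] ∑ (h x) f
∑-concatMap h []       f = refl
∑-concatMap h (x ∷ xs) f = trans (∑-++ (h x) _ f) (cong (∑ (h x) f +_) (∑-concatMap h xs f))

∑-comm : ∀ (xs : List A) (ys : List B) (f : A → B → ℚ) →
         ∑[ x ∈ xs ] ∑[ y ∈ ys ] f x y ≡ ∑[ y ∈ ys ] ∑[ x ∈ xs ] f x y
∑-comm []       ys f = sym (∑-zero ys)
∑-comm (x ∷ xs) ys f = begin
  ∑ ys (f x) + ∑[ x′ ∈ xs ] ∑[ y ∈ ys ] f x′ y  ≡⟨ cong (∑ ys (f x) +_) (∑-comm xs ys f) ⟩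
  ∑ ys (f x) + ∑[ y ∈ ys ] ∑[ x′ ∈ xs ] f x′ y  ≡⟨ sym (∑-distrib-+ ys (f x) _) ⟩
  ∑[ y ∈ ys ] (f x y + ∑[ x′ ∈ xs ] f x′ y)     ∎

∑-product : ∀ (xs : List A) (ys : List B) (f : A → ℚ) (g : B → ℚ) →
            ∑[ x ∈ xs ] ∑[ y ∈ ys ] (f x * g y) ≡ ∑ xs f * ∑ ys g
∑-product xs ys f g = begin
  ∑[ x ∈ xs ] ∑[ y ∈ ys ] (f x * g y)  ≡⟨ sym (∑-cong xs (λ x → *-distribˡ-∑ (f x) ys g)) ⟩
  ∑[ x ∈ xs ] (f x * ∑ ys g)           ≡⟨ ∑-cong xs (λ x → *-comm (f x) _) ⟩
  ∑[ x ∈ xs ] (∑ ys g * f x)           ≡⟨ sym (*-distribˡ-∑ (∑ ys g) xs f) ⟩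
  ∑ ys g * ∑ xs f                      ≡⟨ *-comm (∑ ys g) _ ⟩
  ∑ xs f * ∑ ys g                      ∎

∑-singleton : ∀ (x : A) (f : A → ℚ) → ∑ [ x ] f ≡ f x
∑-singleton x f = +-identityʳ (f x)

∑-cartesianProduct : ∀ (xs : List A) (ys : List B) (f : A × B → ℚ) →
                     ∑ (cartesianProduct xs ys) f ≡ ∑[ x ∈ xs ] ∑[ y ∈ ys ] f (x , y)
∑-cartesianProduct []       ys f = refl
∑-cartesianProduct (x ∷ xs) ys f = begin
  ∑ (List.map (x ,_) ys ++ cartesianProduct xs ys) f
    ≡⟨ ∑-++ (List.map (x ,_) ys) _ f ⟩
  ∑ (List.map (x ,_) ys) f + ∑ (cartesianProduct xs ys) f
    ≡⟨ cong₂ _+_ (∑-map (x ,_) ys f) (∑-cartesianProduct xs ys f) ⟩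
  ∑[ y ∈ ys ] f (x , y) + ∑[ x′ ∈ xs ] ∑[ y ∈ ys ] f (x′ , y) ∎

∑-vecsOver : ∀ (xs : List A) m (f : Vec A (suc m) → ℚ) →
             ∑ (vecsOver xs (suc m)) f ≡ ∑[ a ∈ xs ] ∑[ v ∈ vecsOver xs m ] f (a ∷ v)
∑-vecsOver xs m f =
  trans (∑-concatMap _ xs f) (∑-cong xs (λ a → ∑-map (a ∷_) (vecsOver xs m) f))

∑-allFin : ∀ m (f : Fin (suc m) → ℚ) → ∑ (allFin (suc m)) f ≡ f zero + ∑[ i ∈ allFin m ] f (suc i)
∑-allFin m f = cong (f zero +_) (begin
  ∑ (List.tabulate suc) f           ≡⟨ cong (λ is → ∑ is f) (sym (List.map-tabulate (λ i → i) suc)) ⟩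
  ∑ (List.map suc (allFin m)) f     ≡⟨ ∑-map suc (allFin m) f ⟩
  ∑[ i ∈ allFin m ] f (suc i)       ∎)

∑-*-∑ : ∀ (xs : List A) (ys : List B) (c : A → ℚ) (g : A → B → ℚ) →
        ∑[ x ∈ xs ] (c x * ∑[ y ∈ ys ] g x y) ≡ ∑[ y ∈ ys ] ∑[ x ∈ xs ] (c x * g x y)
∑-*-∑ xs ys c g = trans (∑-cong xs (λ x → *-distribˡ-∑ (c x) ys (g x))) (∑-comm xs ys _)

∑-upTo-sucˡ : ∀ n (f : ℕ → ℚ) → ∑ (upTo (suc n)) f ≡ f 0 + ∑[ i ∈ upTo n ] f (suc i)
∑-upTo-sucˡ n f = cong (f 0 +_) (begin
  ∑ (List.applyUpTo suc n) f     ≡⟨ cong (λ is → ∑ is f) (sym (List.map-upTo suc n)) ⟩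
  ∑ (List.map suc (upTo n)) f    ≡⟨ ∑-map suc (upTo n) f ⟩
  ∑[ i ∈ upTo n ] f (suc i)      ∎)

∑-upTo-sucʳ : ∀ n (f : ℕ → ℚ) → ∑ (upTo (suc n)) f ≡ ∑ (upTo n) f + f n
∑-upTo-sucʳ n f = begin
  ∑ (upTo (suc n)) f           ≡⟨ cong (λ is → ∑ is f) (sym (List.upTo-∷ʳ n)) ⟩
  ∑ (upTo n List.∷ʳ n) f       ≡⟨ ∑-++ (upTo n) [ n ] f ⟩
  ∑ (upTo n) f + ∑ [ n ] f     ≡⟨ cong (∑ (upTo n) f +_) (∑-singleton n f) ⟩
  ∑ (upTo n) f + f n           ∎

infix 5 _when_

_when_ : ℚ → Bool → ℚ
q when b = if b then q else 0ℚ

*-when : ∀ p q b → p * (q when b) ≡ (p * q) when b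
*-when p q true  = refl
*-when p q false = *-zeroʳ p

when-∧ : ∀ p q b c → (p * q) when (b ∧ c) ≡ (p * (q when c)) when b
when-∧ p q true  c = sym (*-when p q c)
when-∧ p q false c = refl

∑-when : ∀ (xs : List A) (f : A → ℚ) b → ∑[ x ∈ xs ] (f x when b) ≡ ∑ xs f when b
∑-when xs f true  = refl
∑-when xs f false = ∑-zero xs

≟0-+ : ∀ m n → ⌊ m ℕ.+ n ℕ.≟ 0 ⌋ ≡ ⌊ m ℕ.≟ 0 ⌋ ∧ ⌊ n ℕ.≟ 0 ⌋
≟0-+ zero    n = refl
≟0-+ (suc m) n = refl

≟-suc : ∀ m n → ⌊ suc m ℕ.≟ suc n ⌋ ≡ ⌊ m ℕ.≟ n ⌋
≟-suc m n with m ℕ.≟ n | suc m ℕ.≟ suc n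
... | yes _   | yes _    = refl
... | no  _   | no  _    = refl
... | yes m≡n | no  m≢n  = ⊥-elim (m≢n (cong suc m≡n))
... | no  m≢n | yes m≡n  = ⊥-elim (m≢n (ℕ.suc-injective m≡n))

𝟙 : Bool → ℚ
𝟙 b = 1ℚ when b

𝟙-∧ : ∀ b c → 𝟙 (b ∧ c) ≡ 𝟙 b * 𝟙 c
𝟙-∧ true  c = sym (*-identityˡ (𝟙 c))
𝟙-∧ false c = sym (*-zeroˡ (𝟙 c))

import Algebra.Properties.Semiring.Mult (CommutativeRing.semiring +-*-commutativeRing) as Mult

ι : ℕ → ℚ
ι n = n Mult.× 1ℚ

ι-+ : ∀ m n → ι (m ℕ.+ n) ≡ ι m + ι n
ι-+ = Mult.×-homo-+ 1ℚ

ι-* : ∀ m n → ι (m ℕ.* n) ≡ ι m * ι n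
ι-* = Mult.×1-homo-*

toℚᵘ-ι : ∀ n → toℚᵘ (ι n) ℚᵘ.≃ ℚᵘ.mkℚᵘ (ℤ.+ n) 0
toℚᵘ-ι zero    = ℚᵘ.≃-refl
toℚᵘ-ι (suc n) = ℚᵘ.≃-trans (toℚᵘ-homo-+ 1ℚ (ι n))
  (ℚᵘ.≃-trans (ℚᵘ.+-congʳ (toℚᵘ 1ℚ) (toℚᵘ-ι n)) (ℚᵘ.*≡* cross-multiplied))
  where
  import Data.Integer.Properties as ℤ
  cross-multiplied : (ℤ.1ℤ ℤ.* ℤ.1ℤ ℤ.+ ℤ.+ n ℤ.* ℤ.1ℤ) ℤ.* ℤ.1ℤ ≡ ℤ.+ suc n ℤ.* (ℤ.1ℤ ℤ.* ℤ.1ℤ)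
  cross-multiplied = trans (ℤ.*-identityʳ _)
    (trans (cong (λ z → ℤ.1ℤ ℤ.+ z) (ℤ.*-identityʳ (ℤ.+ n))) (sym (ℤ.*-identityʳ _)))

*-inverseˡ-ι : ∀ d .{{_ : NonZero d}} → (ℤ.+ 1 / d) * ι d ≡ 1ℚ
*-inverseˡ-ι (suc d) = toℚᵘ-injective (ℚᵘ.≃-trans (toℚᵘ-homo-* (ℤ.+ 1 / suc d) (ι (suc d)))
  (ℚᵘ.≃-trans (ℚᵘ.*-cong (toℚᵘ-fromℚᵘ (ℚᵘ.mkℚᵘ (ℤ.+ 1) d)) (toℚᵘ-ι (suc d)))
              (ℚᵘ.*-inverseˡ (ℚᵘ.mkℚᵘ (ℤ.+ suc d) 0))))

poissonMass-*-ι! : ∀ n → poissonMass n * ι (n !) ≡ 1ℚ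
poissonMass-*-ι! n = *-inverseˡ-ι (n !) {{n !≢0}}

ι-*-poissonMass : ∀ n → ι (suc n) * poissonMass (suc n) ≡ poissonMass n
ι-*-poissonMass n = begin
  ι (suc n) * poissonMass (suc n)
    ≡⟨ sym (*-identityʳ _) ⟩
  ι (suc n) * poissonMass (suc n) * 1ℚ
    ≡⟨ cong (ι (suc n) * poissonMass (suc n) *_) (sym (poissonMass-*-ι! n)) ⟩
  ι (suc n) * poissonMass (suc n) * (poissonMass n * ι (n !))
    ≡⟨ solve 4 (λ s p p′ f → s :* p :* (p′ :* f) := p′ :* (p :* (s :* f))) refl
               (ι (suc n)) (poissonMass (suc n)) (poissonMass n) (ι (n !)) ⟩
  poissonMass n * (poissonMass (suc n) * (ι (suc n) * ι (n !)))
    ≡⟨ cong (λ z → poissonMass n * (poissonMass (suc n) * z)) (sym (ι-* (suc n) (n !))) ⟩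
  poissonMass n * (poissonMass (suc n) * ι (suc n !))
    ≡⟨ cong (poissonMass n *_) (poissonMass-*-ι! (suc n)) ⟩
  poissonMass n * 1ℚ
    ≡⟨ *-identityʳ _ ⟩
  poissonMass n ∎

ι-when-≟ : ∀ m K q → ι m * (q when ⌊ m ℕ.≟ K ⌋) ≡ ι K * (q when ⌊ m ℕ.≟ K ⌋)
ι-when-≟ m K q with m ℕ.≟ K
... | yes refl = refl
... | no  _    = trans (*-zeroʳ (ι m)) (sym (*-zeroʳ (ι K)))

ι-+-split : ∀ k l (p q h : ℚ) → ι (k ℕ.+ l) * (p * q * h) ≡ q * (ι k * (p * h)) + p * (ι l * (q * h))
ι-+-split k l p q h = trans (cong (_* (p * q * h)) (ι-+ k l))
  (solve 5 (λ k l p q h → (k :+ l) :* (p :* q :* h) := q :* (k :* (p :* h)) :+ p :* (l :* (q :* h)))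
         refl (ι k) (ι l) p q h)

sumWalks : List B → (B → A → A) → A → ℕ → (A → ℚ) → ℚ
sumWalks moves act start zero    F = F start
sumWalks moves act start (suc k) F = ∑[ m ∈ moves ] sumWalks moves act start k (F ∘ act m)

sumWalks-cong : ∀ (moves : List B) (act : B → A → A) start k {F G : A → ℚ} →
                (∀ x → F x ≡ G x) → sumWalks moves act start k F ≡ sumWalks moves act start k G
sumWalks-cong moves act start zero    F≗G = F≗G start
sumWalks-cong moves act start (suc k) F≗G =
  ∑-cong moves (λ m → sumWalks-cong moves act start k (F≗G ∘ act m))

-- Configurations of balls in slots, listed by `configs`, whose `weight` is their probability
-- up to a constant factor normalised so that the empty urn has weight 1 (`layer-zero`);
-- `layer k F` is thus proportional to E[F ; size = k].  `size-bias` is the Poisson identity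
-- E[|X| H(X)] = Σₛ E[H(add s X)], demanded only for H vanishing above size N so that
-- `configs` may be a finite truncation.
record Urn (N : ℕ) : Set₁ where
  field
    Config   : Set
    configs  : List Config
    size     : Config → ℕ
    weight   : Config → ℚ
    Slot     : Set
    slots    : List Slot
    add      : Slot → Config → Config
    empty    : Config
    size-add : ∀ s x → size (add s x) ≡ suc (size x)

  layer : ℕ → (Config → ℚ) → ℚ
  layer k F = ∑[ x ∈ configs ] (weight x * F x when ⌊ size x ℕ.≟ k ⌋)

  field
    layer-zero : ∀ (F : Config → ℚ) → layer 0 F ≡ F empty
    size-bias  : ∀ (H : Config → ℚ) → (∀ x → N < size x → H x ≡ 0ℚ) →
                 ∑[ x ∈ configs ] (ι (size x) * (weight x * H x))
                   ≡ ∑[ s ∈ slots ] ∑[ y ∈ configs ] (weight y * H (add s y))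

  walks : ℕ → (Config → ℚ) → ℚ
  walks = sumWalks slots add empty

module _ {N : ℕ} (U : Urn N) where
  open Urn U

  layer-suc : ∀ k → suc k ≤ N → ∀ (F : Config → ℚ) →
              ι (suc k) * layer (suc k) F ≡ ∑[ s ∈ slots ] layer k (F ∘ add s)
  layer-suc k k<N F = begin
    ι (suc k) * layer (suc k) F
      ≡⟨ *-distribˡ-∑ (ι (suc k)) configs _ ⟩
    ∑[ x ∈ configs ] (ι (suc k) * (weight x * F x when ⌊ size x ℕ.≟ suc k ⌋))
      ≡⟨ ∑-cong configs (λ x → sym (size-weighted x)) ⟩
    ∑[ x ∈ configs ] (ι (size x) * (weight x * H x))
      ≡⟨ size-bias H H-vanishes ⟩
    ∑[ s ∈ slots ] ∑[ y ∈ configs ] (weight y * H (add s y))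
      ≡⟨ ∑-cong slots (λ s → ∑-cong configs (λ y → H-after-add s y)) ⟩
    ∑[ s ∈ slots ] layer k (F ∘ add s) ∎
    where
    H : Config → ℚ
    H x = F x when ⌊ size x ℕ.≟ suc k ⌋

    H-vanishes : ∀ x → N < size x → H x ≡ 0ℚ
    H-vanishes x N<size with size x ℕ.≟ suc k
    ... | yes size≡ = ⊥-elim (ℕ.<⇒≱ N<size (subst (_≤ N) (sym size≡) k<N))
    ... | no  _     = refl

    size-weighted : ∀ x → ι (size x) * (weight x * H x)
                            ≡ ι (suc k) * (weight x * F x when ⌊ size x ℕ.≟ suc k ⌋)
    size-weighted x = trans (cong (ι (size x) *_) (*-when (weight x) (F x) _)) (ι-when-≟ (size x) (suc k) _)

    H-after-add : ∀ s y → weight y * H (add s y) ≡ (weight y * F (add s y) when ⌊ size y ℕ.≟ k ⌋)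
    H-after-add s y rewrite size-add s y | ≟-suc (size y) k = *-when (weight y) (F (add s y)) _

  ι!-*-layer : ∀ k → k ≤ N → ∀ (F : Config → ℚ) → ι (k !) * layer k F ≡ walks k F
  ι!-*-layer zero    _   F = trans (*-identityˡ _) (layer-zero F)
  ι!-*-layer (suc k) k<N F = begin
    ι (suc k !) * layer (suc k) F
      ≡⟨ cong (_* layer (suc k) F) (ι-* (suc k) (k !)) ⟩
    ι (suc k) * ι (k !) * layer (suc k) F
      ≡⟨ solve 3 (λ s f l → s :* f :* l := f :* (s :* l)) refl (ι (suc k)) (ι (k !)) _ ⟩
    ι (k !) * (ι (suc k) * layer (suc k) F)
      ≡⟨ cong (ι (k !) *_) (layer-suc k k<N F) ⟩
    ι (k !) * ∑[ s ∈ slots ] layer k (F ∘ add s)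
      ≡⟨ *-distribˡ-∑ (ι (k !)) slots _ ⟩
    ∑[ s ∈ slots ] (ι (k !) * layer k (F ∘ add s))
      ≡⟨ ∑-cong slots (λ s → ι!-*-layer k (ℕ.<⇒≤ k<N) (F ∘ add s)) ⟩
    walks (suc k) F ∎

  layer≡poissonMass*walks : ∀ k → k ≤ N → ∀ (F : Config → ℚ) → layer k F ≡ poissonMass k * walks k F
  layer≡poissonMass*walks k k≤N F = begin
    layer k F                                  ≡⟨ sym (*-identityˡ _) ⟩
    1ℚ * layer k F                             ≡⟨ cong (_* layer k F) (sym (poissonMass-*-ι! k)) ⟩
    poissonMass k * ι (k !) * layer k F        ≡⟨ *-assoc (poissonMass k) _ _ ⟩
    poissonMass k * (ι (k !) * layer k F)      ≡⟨ cong (poissonMass k *_) (ι!-*-layer k k≤N F) ⟩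
    poissonMass k * walks k F                  ∎

poissonUrn : ∀ N → Urn N
poissonUrn N = record
  { Config     = ℕ
  ; configs    = upTo (suc N)
  ; size       = λ a → a
  ; weight     = poissonMass
  ; Slot       = ⊤
  ; slots      = [ tt ]
  ; add        = λ _ → suc
  ; empty      = 0
  ; size-add   = λ _ _ → refl
  ; layer-zero = layer-zero
  ; size-bias  = size-bias
  }
  where
  layer-zero : ∀ F → ∑[ a ∈ upTo (suc N) ] (poissonMass a * F a when ⌊ a ℕ.≟ 0 ⌋) ≡ F 0
  layer-zero F = begin
    ∑[ a ∈ upTo (suc N) ] (poissonMass a * F a when ⌊ a ℕ.≟ 0 ⌋)
      ≡⟨ ∑-upTo-sucˡ N (λ a → poissonMass a * F a when ⌊ a ℕ.≟ 0 ⌋) ⟩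
    1ℚ * F 0 + ∑[ i ∈ upTo N ] 0ℚ
      ≡⟨ cong₂ _+_ (*-identityˡ (F 0)) (∑-zero (upTo N)) ⟩
    F 0 + 0ℚ
      ≡⟨ +-identityʳ (F 0) ⟩
    F 0 ∎

  size-bias : ∀ H → (∀ a → N < a → H a ≡ 0ℚ) →
              ∑[ a ∈ upTo (suc N) ] (ι a * (poissonMass a * H a))
                ≡ ∑[ s ∈ [ tt ] ] ∑[ b ∈ upTo (suc N) ] (poissonMass b * H (suc b))
  size-bias H H-vanishes = begin
    ∑[ a ∈ upTo (suc N) ] (ι a * (poissonMass a * H a))
      ≡⟨ ∑-upTo-sucˡ N (λ a → ι a * (poissonMass a * H a)) ⟩
    0ℚ * (poissonMass 0 * H 0) + ∑[ b ∈ upTo N ] (ι (suc b) * (poissonMass (suc b) * H (suc b)))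
      ≡⟨ cong₂ _+_ (*-zeroˡ (poissonMass 0 * H 0)) (∑-cong (upTo N) lowered) ⟩
    0ℚ + ∑[ b ∈ upTo N ] (poissonMass b * H (suc b))
      ≡⟨ +-identityˡ _ ⟩
    ∑[ b ∈ upTo N ] (poissonMass b * H (suc b))
      ≡⟨ sym (+-identityʳ _) ⟩
    ∑[ b ∈ upTo N ] (poissonMass b * H (suc b)) + 0ℚ
      ≡⟨ cong (∑[ b ∈ upTo N ] (poissonMass b * H (suc b)) +_) top-vanishes ⟩
    ∑[ b ∈ upTo N ] (poissonMass b * H (suc b)) + poissonMass N * H (suc N)
      ≡⟨ sym (∑-upTo-sucʳ N (λ b → poissonMass b * H (suc b))) ⟩
    ∑[ b ∈ upTo (suc N) ] (poissonMass b * H (suc b))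
      ≡⟨ sym (∑-singleton tt (λ _ → ∑[ b ∈ upTo (suc N) ] (poissonMass b * H (suc b)))) ⟩
    ∑[ s ∈ [ tt ] ] ∑[ b ∈ upTo (suc N) ] (poissonMass b * H (suc b)) ∎
    where
    lowered : ∀ b → ι (suc b) * (poissonMass (suc b) * H (suc b)) ≡ poissonMass b * H (suc b)
    lowered b = trans (sym (*-assoc (ι (suc b)) _ _)) (cong (_* H (suc b)) (ι-*-poissonMass b))

    top-vanishes : 0ℚ ≡ poissonMass N * H (suc N)
    top-vanishes = sym (trans (cong (poissonMass N *_) (H-vanishes (suc N) (ℕ.n<1+n N))) (*-zeroʳ (poissonMass N)))

sum-updateAt-suc : ∀ {m} (v : Vec ℕ m) i → Vec.sum (v [ i ]%= suc) ≡ suc (Vec.sum v)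
sum-updateAt-suc (x ∷ v) zero    = refl
sum-updateAt-suc (x ∷ v) (suc i) = trans (cong (x ℕ.+_) (sum-updateAt-suc v i)) (ℕ.+-suc x (Vec.sum v))

module _ {N : ℕ} (U : Urn N) where
  open Urn U

  private
    V : ∀ m → List (Vec Config m)
    V = vecsOver configs

    sizeᵛ : ∀ {m} → Vec Config m → ℕ
    sizeᵛ v = Vec.sum (Vec.map size v)

    weightᵛ : ∀ {m} → Vec Config m → ℚ
    weightᵛ v = prodℚ (Vec.map weight v)

    slotsᵛ : ∀ m → List (Fin m × Slot)
    slotsᵛ m = cartesianProduct (allFin m) slots

    addᵛ : ∀ {m} → Fin m × Slot → Vec Config m → Vec Config m
    addᵛ (i , s) v = v [ i ]%= add s

    sizeᵛ-add : ∀ {m} (τ : Fin m × Slot) v → sizeᵛ (addᵛ τ v) ≡ suc (sizeᵛ v)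
    sizeᵛ-add (i , s) v = trans (cong Vec.sum (Vec.map-updateAt v i (size-add s (Vec.lookup v i))))
                                (sum-updateAt-suc (Vec.map size v) i)

    layer-zeroᵛ : ∀ m (F : Vec Config m → ℚ) →
                  ∑[ x ∈ V m ] (weightᵛ x * F x when ⌊ sizeᵛ x ℕ.≟ 0 ⌋) ≡ F (replicate m empty)
    layer-zeroᵛ zero    F = trans (+-identityʳ _) (*-identityˡ (F []))
    layer-zeroᵛ (suc m) F = begin
      ∑[ x ∈ V (suc m) ] (weightᵛ x * F x when ⌊ sizeᵛ x ℕ.≟ 0 ⌋)
        ≡⟨ ∑-vecsOver configs m _ ⟩
      ∑[ a ∈ configs ] ∑[ v ∈ V m ] (weight a * weightᵛ v * F (a ∷ v) when ⌊ size a ℕ.+ sizeᵛ v ℕ.≟ 0 ⌋)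
        ≡⟨ ∑-cong configs (λ a → trans (∑-cong (V m) (split a)) (∑-when (V m) _ _)) ⟩
      ∑[ a ∈ configs ] (∑[ v ∈ V m ] (weight a * (weightᵛ v * F (a ∷ v) when ⌊ sizeᵛ v ℕ.≟ 0 ⌋)) when ⌊ size a ℕ.≟ 0 ⌋)
        ≡⟨ ∑-cong configs (λ a → cong (_when ⌊ size a ℕ.≟ 0 ⌋) (sym (*-distribˡ-∑ (weight a) (V m) _))) ⟩
      layer 0 (λ a → ∑[ v ∈ V m ] (weightᵛ v * F (a ∷ v) when ⌊ sizeᵛ v ℕ.≟ 0 ⌋))
        ≡⟨ layer-zero _ ⟩
      ∑[ v ∈ V m ] (weightᵛ v * F (empty ∷ v) when ⌊ sizeᵛ v ℕ.≟ 0 ⌋)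
        ≡⟨ layer-zeroᵛ m (λ v → F (empty ∷ v)) ⟩
      F (replicate (suc m) empty) ∎
      where
      split : ∀ a v → (weight a * weightᵛ v * F (a ∷ v) when ⌊ size a ℕ.+ sizeᵛ v ℕ.≟ 0 ⌋)
                        ≡ (weight a * (weightᵛ v * F (a ∷ v) when ⌊ sizeᵛ v ℕ.≟ 0 ⌋) when ⌊ size a ℕ.≟ 0 ⌋)
      split a v rewrite ≟0-+ (size a) (sizeᵛ v) | *-assoc (weight a) (weightᵛ v) (F (a ∷ v)) =
        when-∧ (weight a) _ ⌊ size a ℕ.≟ 0 ⌋ ⌊ sizeᵛ v ℕ.≟ 0 ⌋

    size-biasᵛ : ∀ m (H : Vec Config m → ℚ) → (∀ x → N < sizeᵛ x → H x ≡ 0ℚ) →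
                 ∑[ x ∈ V m ] (ι (sizeᵛ x) * (weightᵛ x * H x))
                   ≡ ∑[ τ ∈ slotsᵛ m ] ∑[ y ∈ V m ] (weightᵛ y * H (addᵛ τ y))
    size-biasᵛ zero    H _ = trans (+-identityʳ _) (*-zeroˡ (1ℚ * H []))
    size-biasᵛ (suc m) H H-vanishes = begin
      ∑[ x ∈ V (suc m) ] (ι (sizeᵛ x) * (weightᵛ x * H x))
        ≡⟨ ∑-vecsOver configs m _ ⟩
      ∑[ a ∈ configs ] ∑[ v ∈ V m ] (ι (size a ℕ.+ sizeᵛ v) * (weight a * weightᵛ v * H (a ∷ v)))
        ≡⟨ ∑-cong configs (λ a → trans (∑-cong (V m) (λ v → ι-+-split (size a) (sizeᵛ v) (weight a) (weightᵛ v) (H (a ∷ v))))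
                                        (∑-distrib-+ (V m) (head a) (tail a))) ⟩
      ∑[ a ∈ configs ] (∑[ v ∈ V m ] head a v + ∑[ v ∈ V m ] tail a v)
        ≡⟨ ∑-distrib-+ configs _ _ ⟩
      ∑[ a ∈ configs ] ∑[ v ∈ V m ] head a v + ∑[ a ∈ configs ] ∑[ v ∈ V m ] tail a v
        ≡⟨ cong₂ _+_ head-sum tail-sum ⟩
      ∑[ s ∈ slots ] G (zero , s) + ∑[ i ∈ allFin m ] ∑[ s ∈ slots ] G (suc i , s)
        ≡⟨ sym (∑-allFin m (λ i → ∑[ s ∈ slots ] G (i , s))) ⟩
      ∑[ i ∈ allFin (suc m) ] ∑[ s ∈ slots ] G (i , s)
        ≡⟨ sym (∑-cartesianProduct (allFin (suc m)) slots G) ⟩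
      ∑[ τ ∈ slotsᵛ (suc m) ] G τ ∎
      where
      G : Fin (suc m) × Slot → ℚ
      G τ = ∑[ y ∈ V (suc m) ] (weightᵛ y * H (addᵛ τ y))

      head tail : Config → Vec Config m → ℚ
      head a v = weightᵛ v * (ι (size a) * (weight a * H (a ∷ v)))
      tail a v = weight a * (ι (sizeᵛ v) * (weightᵛ v * H (a ∷ v)))

      head-sum : ∑[ a ∈ configs ] ∑[ v ∈ V m ] head a v ≡ ∑[ s ∈ slots ] G (zero , s)
      head-sum = begin
        ∑[ a ∈ configs ] ∑[ v ∈ V m ] head a v
          ≡⟨ ∑-comm configs (V m) head ⟩
        ∑[ v ∈ V m ] ∑[ a ∈ configs ] head a v
          ≡⟨ ∑-cong (V m) (λ v → sym (*-distribˡ-∑ (weightᵛ v) configs _)) ⟩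
        ∑[ v ∈ V m ] (weightᵛ v * ∑[ a ∈ configs ] (ι (size a) * (weight a * H (a ∷ v))))
          ≡⟨ ∑-cong (V m) (λ v → cong (weightᵛ v *_) (size-bias (λ a → H (a ∷ v)) (head-vanishes v))) ⟩
        ∑[ v ∈ V m ] (weightᵛ v * ∑[ s ∈ slots ] ∑[ b ∈ configs ] (weight b * H (add s b ∷ v)))
          ≡⟨ ∑-*-∑ (V m) slots weightᵛ _ ⟩
        ∑[ s ∈ slots ] ∑[ v ∈ V m ] (weightᵛ v * ∑[ b ∈ configs ] (weight b * H (add s b ∷ v)))
          ≡⟨ ∑-cong slots (λ s → ∑-*-∑ (V m) configs weightᵛ _) ⟩
        ∑[ s ∈ slots ] ∑[ b ∈ configs ] ∑[ v ∈ V m ] (weightᵛ v * (weight b * H (add s b ∷ v)))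
          ≡⟨ ∑-cong slots (λ s → ∑-cong configs (λ b → ∑-cong (V m) (λ v →
               solve 3 (λ v b h → v :* (b :* h) := b :* v :* h) refl (weightᵛ v) (weight b) _))) ⟩
        ∑[ s ∈ slots ] ∑[ b ∈ configs ] ∑[ v ∈ V m ] (weight b * weightᵛ v * H (add s b ∷ v))
          ≡⟨ ∑-cong slots (λ s → sym (∑-vecsOver configs m _)) ⟩
        ∑[ s ∈ slots ] G (zero , s) ∎
        where
        head-vanishes : ∀ v a → N < size a → H (a ∷ v) ≡ 0ℚ
        head-vanishes v a N<size = H-vanishes (a ∷ v) (ℕ.<-≤-trans N<size (ℕ.m≤m+n (size a) (sizeᵛ v)))

      tail-sum : ∑[ a ∈ configs ] ∑[ v ∈ V m ] tail a v ≡ ∑[ i ∈ allFin m ] ∑[ s ∈ slots ] G (suc i , s)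
      tail-sum = begin
        ∑[ a ∈ configs ] ∑[ v ∈ V m ] tail a v
          ≡⟨ ∑-cong configs (λ a → sym (*-distribˡ-∑ (weight a) (V m) _)) ⟩
        ∑[ a ∈ configs ] (weight a * ∑[ v ∈ V m ] (ι (sizeᵛ v) * (weightᵛ v * H (a ∷ v))))
          ≡⟨ ∑-cong configs (λ a → cong (weight a *_) (size-biasᵛ m (λ v → H (a ∷ v)) (tail-vanishes a))) ⟩
        ∑[ a ∈ configs ] (weight a * ∑[ τ ∈ slotsᵛ m ] ∑[ u ∈ V m ] (weightᵛ u * H (a ∷ addᵛ τ u)))
          ≡⟨ ∑-*-∑ configs (slotsᵛ m) weight _ ⟩
        ∑[ τ ∈ slotsᵛ m ] ∑[ a ∈ configs ] (weight a * ∑[ u ∈ V m ] (weightᵛ u * H (a ∷ addᵛ τ u)))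
          ≡⟨ ∑-cong (slotsᵛ m) (λ τ → ∑-cong configs (λ a → *-distribˡ-∑ (weight a) (V m) _)) ⟩
        ∑[ τ ∈ slotsᵛ m ] ∑[ a ∈ configs ] ∑[ u ∈ V m ] (weight a * (weightᵛ u * H (a ∷ addᵛ τ u)))
          ≡⟨ ∑-cong (slotsᵛ m) (λ τ → ∑-cong configs (λ a → ∑-cong (V m) (λ u → sym (*-assoc (weight a) _ _)))) ⟩
        ∑[ τ ∈ slotsᵛ m ] ∑[ a ∈ configs ] ∑[ u ∈ V m ] (weight a * weightᵛ u * H (a ∷ addᵛ τ u))
          ≡⟨ ∑-cong (slotsᵛ m) (λ { (i , s) → sym (∑-vecsOver configs m _) }) ⟩
        ∑[ τ ∈ slotsᵛ m ] G (suc (proj₁ τ) , proj₂ τ)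
          ≡⟨ ∑-cartesianProduct (allFin m) slots _ ⟩
        ∑[ i ∈ allFin m ] ∑[ s ∈ slots ] G (suc i , s) ∎
        where
        tail-vanishes : ∀ a v → N < sizeᵛ v → H (a ∷ v) ≡ 0ℚ
        tail-vanishes a v N<size = H-vanishes (a ∷ v) (ℕ.<-≤-trans N<size (ℕ.m≤n+m (sizeᵛ v) (size a)))

  vecUrn : ℕ → Urn N
  vecUrn m = record
    { Config     = Vec Config m
    ; configs    = V m
    ; size       = sizeᵛ
    ; weight     = weightᵛ
    ; Slot       = Fin m × Slot
    ; slots      = slotsᵛ m
    ; add        = addᵛ
    ; empty      = replicate m empty
    ; size-add   = sizeᵛ-add
    ; layer-zero = layer-zeroᵛ m
    ; size-bias  = size-biasᵛ m
    }

bump : ∀ {m} → Fin m → Vec ℕ m → Vec ℕ m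
bump i v = v [ i ]%= suc

occupancySum : ∀ m → ℕ → (Vec ℕ m → ℚ) → ℚ
occupancySum m = sumWalks (allFin m) bump (replicate m 0)

sum-replicate-0 : ∀ m → Vec.sum (replicate m 0) ≡ 0
sum-replicate-0 zero    = refl
sum-replicate-0 (suc m) = sum-replicate-0 m

zipWith-+-bumpˡ : ∀ {m} (u v : Vec ℕ m) j → zipWith ℕ._+_ (bump j u) v ≡ bump j (zipWith ℕ._+_ u v)
zipWith-+-bumpˡ (a ∷ u) (b ∷ v) zero    = refl
zipWith-+-bumpˡ (a ∷ u) (b ∷ v) (suc j) = cong (a ℕ.+ b ∷_) (zipWith-+-bumpˡ u v j)

zipWith-+-bumpʳ : ∀ {m} (u v : Vec ℕ m) j → zipWith ℕ._+_ u (bump j v) ≡ bump j (zipWith ℕ._+_ u v)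
zipWith-+-bumpʳ (a ∷ u) (b ∷ v) zero    = cong (_∷ zipWith ℕ._+_ u v) (ℕ.+-suc a b)
zipWith-+-bumpʳ (a ∷ u) (b ∷ v) (suc j) = cong (a ℕ.+ b ∷_) (zipWith-+-bumpʳ u v j)

colSums-∷ : ∀ {p q} (r : Vec ℕ q) (x : Array p q) → colSums (r ∷ x) ≡ zipWith ℕ._+_ r (colSums x)
colSums-∷ r x = map-sum-⊛ r (Vec.transpose x)
  where
  map-sum-⊛ : ∀ {p q} (r : Vec ℕ q) (t : Vec (Vec ℕ p) q) →
              Vec.map Vec.sum (replicate q _∷_ Vec.⊛ r Vec.⊛ t) ≡ zipWith ℕ._+_ r (Vec.map Vec.sum t)
  map-sum-⊛ []      []      = refl
  map-sum-⊛ (a ∷ r) (c ∷ t) = cong (a ℕ.+ Vec.sum c ∷_) (map-sum-⊛ r t)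

rowSums-bump : ∀ {p q} (x : Array p q) i j → rowSums (x [ i ]%= bump j) ≡ bump i (rowSums x)
rowSums-bump x i j = Vec.map-updateAt x i (sum-updateAt-suc (Vec.lookup x i) j)

colSums-bump : ∀ {p q} (x : Array p q) i j → colSums (x [ i ]%= bump j) ≡ bump j (colSums x)
colSums-bump (r ∷ x) zero j = begin
  colSums (bump j r ∷ x)                     ≡⟨ colSums-∷ (bump j r) x ⟩
  zipWith ℕ._+_ (bump j r) (colSums x)       ≡⟨ zipWith-+-bumpˡ r (colSums x) j ⟩
  bump j (zipWith ℕ._+_ r (colSums x))       ≡⟨ cong (bump j) (sym (colSums-∷ r x)) ⟩
  bump j (colSums (r ∷ x))                   ∎
colSums-bump (r ∷ x) (suc i) j = begin
  colSums (r ∷ (x [ i ]%= bump j))                  ≡⟨ colSums-∷ r (x [ i ]%= bump j) ⟩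
  zipWith ℕ._+_ r (colSums (x [ i ]%= bump j))      ≡⟨ cong (zipWith ℕ._+_ r) (colSums-bump x i j) ⟩
  zipWith ℕ._+_ r (bump j (colSums x))              ≡⟨ zipWith-+-bumpʳ r (colSums x) j ⟩
  bump j (zipWith ℕ._+_ r (colSums x))              ≡⟨ cong (bump j) (sym (colSums-∷ r x)) ⟩
  bump j (colSums (r ∷ x))                          ∎

rowSums-zero : ∀ p q → rowSums (replicate p (replicate q 0)) ≡ replicate p 0
rowSums-zero p q = trans (Vec.map-replicate Vec.sum (replicate q 0) p) (cong (replicate p) (sum-replicate-0 q))

colSums-zero : ∀ p q → colSums (replicate p (replicate q 0)) ≡ replicate q 0
colSums-zero zero    q = Vec.map-replicate Vec.sum [] q
colSums-zero (suc p) q = begin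
  colSums (replicate (suc p) (replicate q 0))
    ≡⟨ colSums-∷ (replicate q 0) (replicate p (replicate q 0)) ⟩
  zipWith ℕ._+_ (replicate q 0) (colSums (replicate p (replicate q 0)))
    ≡⟨ cong (zipWith ℕ._+_ (replicate q 0)) (colSums-zero p q) ⟩
  zipWith ℕ._+_ (replicate q 0) (replicate q 0)
    ≡⟨ Vec.zipWith-replicate ℕ._+_ 0 0 ⟩
  replicate q 0 ∎

arrayUrn : ∀ N p q → Urn N
arrayUrn N p q = vecUrn (vecUrn (poissonUrn N) q) p

module _ (N p q : ℕ) where
  open Urn (arrayUrn N p q)

  size≡total : ∀ x → size x ≡ total x
  size≡total x = cong Vec.sum (Vec.map-cong (λ r → cong Vec.sum (Vec.map-id r)) x)

  walks-rowSums-colSums : ∀ k (f : Vec ℕ p → ℚ) (g : Vec ℕ q → ℚ) →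
                          walks k (λ x → f (rowSums x) * g (colSums x)) ≡ occupancySum p k f * occupancySum q k g
  walks-rowSums-colSums zero    f g = cong₂ (λ r c → f r * g c) (rowSums-zero p q) (colSums-zero p q)
  walks-rowSums-colSums (suc k) f g = begin
    ∑[ τ ∈ slots ] walks k (λ x → f (rowSums (add τ x)) * g (colSums (add τ x)))
      ≡⟨ ∑-cartesianProduct (allFin p) _ _ ⟩
    ∑[ i ∈ allFin p ] ∑[ σ ∈ cartesianProduct (allFin q) [ tt ] ] W i (proj₁ σ)
      ≡⟨ ∑-cong (allFin p) (λ i → trans (∑-cartesianProduct (allFin q) [ tt ] _)
                                         (∑-cong (allFin q) (λ j → ∑-singleton tt _))) ⟩
    ∑[ i ∈ allFin p ] ∑[ j ∈ allFin q ] W i j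
      ≡⟨ ∑-cong (allFin p) (λ i → ∑-cong (allFin q) (λ j → walks-bump i j)) ⟩
    ∑[ i ∈ allFin p ] ∑[ j ∈ allFin q ] (occupancySum p k (f ∘ bump i) * occupancySum q k (g ∘ bump j))
      ≡⟨ ∑-product (allFin p) (allFin q) _ _ ⟩
    occupancySum p (suc k) f * occupancySum q (suc k) g ∎
    where
    W : Fin p → Fin q → ℚ
    W i j = walks k (λ x → f (rowSums (x [ i ]%= bump j)) * g (colSums (x [ i ]%= bump j)))

    walks-bump : ∀ i j → W i j ≡ occupancySum p k (f ∘ bump i) * occupancySum q k (g ∘ bump j)
    walks-bump i j = trans
      (sumWalks-cong slots add empty k (λ x → cong₂ (λ r c → f r * g c) (rowSums-bump x i j) (colSums-bump x i j)))
      (walks-rowSums-colSums k (f ∘ bump i) (g ∘ bump j))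

module _ (a b n : ℕ) where
  open Urn (arrayUrn n (2 ^ a) (2 ^ b))

  probS≡layer : ∀ (E : Mat a b → Bool) F → (∀ x → 𝟙 (E x) ≡ F x) → probS a b n E ≡ layer n F
  probS≡layer E F 𝟙E≡F = ∑-cong (boundedMats a b n) λ x → begin
    jointMass x when ⌊ total x ℕ.≟ n ⌋ ∧ E x
      ≡⟨ cong (_when ⌊ total x ℕ.≟ n ⌋ ∧ E x) (sym (*-identityʳ (jointMass x))) ⟩
    jointMass x * 1ℚ when ⌊ total x ℕ.≟ n ⌋ ∧ E x
      ≡⟨ when-∧ (jointMass x) 1ℚ _ (E x) ⟩
    jointMass x * 𝟙 (E x) when ⌊ total x ℕ.≟ n ⌋
      ≡⟨ cong₂ (λ e t → jointMass x * e when ⌊ t ℕ.≟ n ⌋) (𝟙E≡F x) (sym (size≡total n _ _ x)) ⟩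
    weight x * F x when ⌊ size x ℕ.≟ n ⌋ ∎

  probS-rowSums-colSums : ∀ (E : Mat a b → Bool) f g → (∀ x → 𝟙 (E x) ≡ f (rowSums x) * g (colSums x)) →
                          probS a b n E ≡ poissonMass n * (occupancySum (2 ^ a) n f * occupancySum (2 ^ b) n g)
  probS-rowSums-colSums E f g 𝟙E≡fg = begin
    probS a b n E
      ≡⟨ probS≡layer E _ 𝟙E≡fg ⟩
    layer n (λ x → f (rowSums x) * g (colSums x))
      ≡⟨ layer≡poissonMass*walks (arrayUrn n _ _) n ℕ.≤-refl _ ⟩
    poissonMass n * walks n (λ x → f (rowSums x) * g (colSums x))
      ≡⟨ cong (poissonMass n *_) (walks-rowSums-colSums n _ _ n f g) ⟩
    poissonMass n * (occupancySum (2 ^ a) n f * occupancySum (2 ^ b) n g) ∎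

mainTheorem9 : (a b : ℕ) → CondIndepRowsColsGivenTotal a b
mainTheorem9 a b n r c = begin
  probS a b n (λ x → rowEvent r x ∧ colEvent c x) * probS a b n (λ _ → true)
    ≡⟨ cong₂ _*_ (probS-rowSums-colSums a b n _ isR isC (λ x → 𝟙-∧ (rowEvent r x) (colEvent c x)))
                 (probS-rowSums-colSums a b n _ one one (λ _ → sym (*-identityʳ 1ℚ))) ⟩
  π * (Oʳ isR * Oᶜ isC) * (π * (Oʳ one * Oᶜ one))
    ≡⟨ solve 5 (λ π x y x₁ y₁ → π :* (x :* y) :* (π :* (x₁ :* y₁)) := π :* (x :* y₁) :* (π :* (x₁ :* y)))
             refl π (Oʳ isR) (Oᶜ isC) (Oʳ one) (Oᶜ one) ⟩
  π * (Oʳ isR * Oᶜ one) * (π * (Oʳ one * Oᶜ isC))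
    ≡⟨ sym (cong₂ _*_ (probS-rowSums-colSums a b n _ isR one (λ _ → sym (*-identityʳ _)))
                      (probS-rowSums-colSums a b n _ one isC (λ _ → sym (*-identityˡ _)))) ⟩
  probS a b n (rowEvent r) * probS a b n (colEvent c) ∎
  where
  π : ℚ
  π = poissonMass n

  Oʳ : (Vec ℕ (2 ^ a) → ℚ) → ℚ
  Oʳ = occupancySum (2 ^ a) n

  Oᶜ : (Vec ℕ (2 ^ b) → ℚ) → ℚ
  Oᶜ = occupancySum (2 ^ b) n

  one : ∀ {m} → Vec ℕ m → ℚ
  one _ = 1ℚ

  isR : Vec ℕ (2 ^ a) → ℚ
  isR s = 𝟙 ⌊ ≡-dec ℕ._≟_ s r ⌋

  isC : Vec ℕ (2 ^ b) → ℚ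
  isC s = 𝟙 ⌊ ≡-dec ℕ._≟_ s c ⌋
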